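{- Let $T$ be the infinite $3$-regular tree, $L(T)$ its line graph, and $\Gamma_2=L(T)\,\square\,L(T)$. Then there exist infinitely many isolated $2$-perfect truncated-metric codes in $\Gamma_2$.
   Context: A tersquare is a copy of $K_3\square K_3$. The graph $\Gamma_2$ (the ternary square compound, or ternary non-lattice superlattice graph) is the infinite graph obtained from one tersquare by iteratively gluing new tersquares along free triangles, so that every triangle lies in exactly two tersquares; concretely it is $L(T)\square L(T)$, whose tersquares are the products $\Delta\times\Delta'$ of triangles $\Delta,\Delta'$ of $L(T)$ (each vertex of $L(T)$ lies in exactly two triangles, so each vertex of $\Gamma_2$ lies in exactly four tersquares). Truncated distance: for vertices $u,v$ of $\Gamma_2$, $\rho(u,v)$ is the graph distance of $\Gamma_2$ between $u,v$ if they lie in a common tersquare, and $\rho(u,v)=3$ otherwise; $\rho(u,S)=\min_{s\in S}\rho(u,s)$. A set $S\subseteq V(\Gamma_2)$ is an isolated $2$-perfect truncated-metric code if no two vertices of $S$ are adjacent, for every vertex $u$ there is a unique $s\in S$ with $\rho(u,s)=\rho(u,S)$, and the truncated spheres $\{u:\rho(u,s)\le 2\}$, $s\in S$, partition $V(\Gamma_2)$. -}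

module Defs where

open import Data.Nat using (ℕ; zero; suc; _≤_)
open import Data.Fin using (Fin)
open import Data.List using (List; []; _∷_)
open import Data.Maybe using (Maybe; just; nothing)
open import Data.Product using (Σ; _×_; _,_; proj₁; proj₂; ∃)
open import Data.Sum using (_⊎_)
open import Relation.Nullary using (¬_)
open import Relation.Binary.PropositionalEquality using (_≡_)

record Graph : Set₁ where
  field
    V   : Set
    Adj : V → V → Set

record EdgeGraph : Set₁ where
  field
    V    : Set
    E    : Set
    end₁ : E → V
    end₂ : E → V

Inc : (G : EdgeGraph) → EdgeGraph.V G → EdgeGraph.E G → Set
Inc G v e = (v ≡ EdgeGraph.end₁ G e) ⊎ (v ≡ EdgeGraph.end₂ G e)

LineGraph : EdgeGraph → Graph
LineGraph G = record
  { V   = EdgeGraph.E G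
  ; Adj = λ e f → ¬ (e ≡ f) × Σ (EdgeGraph.V G) (λ v → Inc G v e × Inc G v f)
  }

_□_ : Graph → Graph → Graph
G □ H = record
  { V   = Graph.V G × Graph.V H
  ; Adj = λ p q → (proj₁ p ≡ proj₁ q × Graph.Adj H (proj₂ p) (proj₂ q))
                ⊎ (Graph.Adj G (proj₁ p) (proj₁ q) × proj₂ p ≡ proj₂ q)
  }

data Walk (G : Graph) : ℕ → Graph.V G → Graph.V G → Set where
  nil  : ∀ {u} → Walk G zero u u
  cons : ∀ {n u w v} → Graph.Adj G u w → Walk G n w v → Walk G (suc n) u v

Dist : (G : Graph) → Graph.V G → Graph.V G → ℕ → Set
Dist G u v n = Walk G n u v × (∀ m → Walk G m u v → n ≤ m)

Triangle : Graph → Set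
Triangle G = Σ (V × V × V) λ { (a , b , c) → Adj a b × Adj b c × Adj a c }
  where open Graph G

InTri : (G : Graph) → Graph.V G → Triangle G → Set
InTri G x ((a , b , c) , _) = x ≡ a ⊎ x ≡ b ⊎ x ≡ c

-- Vertices: the root, and non-root vertices (i , bs): the path from the
-- root starts along branch i : Fin 3 and then at each further step
-- chooses one of the two children (Fin 2); bs lists these choices with
-- the deepest choice first.  Every non-root vertex x is joined to its
-- parent; edges are identified with their lower (child) endpoint.

TNonRoot : Set
TNonRoot = Fin 3 × List (Fin 2)

TVertex : Set
TVertex = Maybe TNonRoot

parent : TNonRoot → TVertex
parent (i , [])     = nothing
parent (i , b ∷ bs) = just (i , bs)

T : EdgeGraph
T = record { V = TVertex ; E = TNonRoot ; end₁ = just ; end₂ = parent }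

LT : Graph
LT = LineGraph T

Γ₂ : Graph
Γ₂ = LT □ LT

V₂ : Set
V₂ = Graph.V Γ₂

-- Tersquares of Γ₂ are the products Δ × Δ' of triangles of L(T).
-- u and v lie in a common tersquare:
CommonTersquare : V₂ → V₂ → Set
CommonTersquare (a , b) (a' , b') =
  Σ (Triangle LT) (λ Δ → InTri LT a Δ × InTri LT a' Δ) ×
  Σ (Triangle LT) (λ Δ' → InTri LT b Δ' × InTri LT b' Δ')

Rho : V₂ → V₂ → ℕ → Set
Rho u v k = (CommonTersquare u v × Dist Γ₂ u v k)
          ⊎ (¬ CommonTersquare u v × k ≡ 3)

RhoSet : (V₂ → Set) → V₂ → ℕ → Set
RhoSet S u k = Σ V₂ (λ s → S s × Rho u s k)
             × (∀ s j → S s → Rho u s j → k ≤ j)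

Sphere2 : V₂ → V₂ → Set
Sphere2 s u = Σ ℕ λ k → Rho u s k × k ≤ 2

record IsIsolated2PerfectCode (S : V₂ → Set) : Set where
  field
    isolated  : ∀ s s' → S s → S s' → ¬ Graph.Adj Γ₂ s s'
    uniqueNearest : ∀ u → Σ ℕ λ k → RhoSet S u k ×
                      Σ V₂ (λ s → S s × Rho u s k ×
                        (∀ s' → S s' → Rho u s' k → s' ≡ s))
    partition : ∀ u → Σ V₂ (λ s → S s × Sphere2 s u ×
                        (∀ s' → S s' → Sphere2 s' u → s' ≡ s))

SameSet : (V₂ → Set) → (V₂ → Set) → Set
SameSet S S' = ∀ x → (S x → S' x) × (S' x → S x)

-- If C is a perfect code of L(T), then C × C is an isolated 2-perfect code of Γ₂: two vertices of Γ₂ share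
-- a tersquare iff they are equal or adjacent in both coordinates, and then lie at distance at most 2, so
-- the truncated 2-spheres around C × C are products of closed neighbourhoods of L(T).  Perfect codes of
-- L(T) are built top-down: the root stays uncovered, and below every vertex that is not yet covered one of
-- its two child edges is chosen for the code.  Different choice rules give different codes, hence
-- infinitely many.
module Submission where

open import Defs
open import Data.Bool using (Bool; true; false; if_then_else_)
open import Data.Empty using (⊥-elim)
open import Data.Fin as Fin using (Fin; zero; suc)
open import Data.List using (List; []; _∷_; length)
open import Data.Maybe using (just; nothing)
open import Data.Nat using (ℕ; zero; suc; _≤_; _<_; _+_; _≤?_; z≤n; s≤s; _≟_)
open import Data.Nat.Properties using (≤-antisym; ≤-trans; ≤-reflexive; ≤-refl; ≰⇒>; <⇒≤; <⇒≢; +-mono-<; +-suc; <-cmp)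
open import Data.Product using (Σ; _×_; _,_; proj₁; proj₂; swap)
open import Data.Sum using (_⊎_; inj₁; inj₂)
open import Function using (case_of_)
open import Relation.Binary.Definitions using (tri<; tri≈; tri>)
open import Relation.Binary.PropositionalEquality using (_≡_; refl; sym; trans; cong; cong₂)
open import Relation.Nullary using (¬_; does; yes; no)
open import Relation.Nullary.Decidable using (dec-true; dec-false)

Closed : (G : Graph) → Graph.V G → Graph.V G → Set
Closed G u v = u ≡ v ⊎ Graph.Adj G u v

IsPerfectCode : (G : Graph) → (Graph.V G → Set) → Set
IsPerfectCode G C =
  ∀ v → Σ (Graph.V G) λ c → C c × Closed G v c × (∀ c' → C c' → Closed G v c' → c' ≡ c)

Irreflexive : Graph → Set
Irreflexive G = ∀ {x} → ¬ Graph.Adj G x x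

perfectCode-independent : ∀ {G C} → Irreflexive G → IsPerfectCode G C →
                          ∀ {c c'} → C c → C c' → ¬ Graph.Adj G c c'
perfectCode-independent irr code {c} {c'} Cc Cc' adj with code c
... | d , _ , _ , unique with unique c Cc (inj₁ refl) | unique c' Cc' (inj₂ adj)
... | refl | refl = irr adj

SharedTriangle : (G : Graph) → Graph.V G → Graph.V G → Set
SharedTriangle G x y = Σ (Triangle G) λ Δ → InTri G x Δ × InTri G y Δ

sharedTriangle⇒closed : ∀ G → (∀ {x y} → Graph.Adj G x y → Graph.Adj G y x) →
                        ∀ {x y} → SharedTriangle G x y → Closed G x y
sharedTriangle⇒closed G sym-adj (Δ@(_ , ab , bc , ac) , x∈ , y∈) = closed x∈ y∈
  where
  closed : ∀ {x y} → InTri G x Δ → InTri G y Δ → Closed G x y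
  closed (inj₁ refl)        (inj₁ refl)        = inj₁ refl
  closed (inj₁ refl)        (inj₂ (inj₁ refl)) = inj₂ ab
  closed (inj₁ refl)        (inj₂ (inj₂ refl)) = inj₂ ac
  closed (inj₂ (inj₁ refl)) (inj₁ refl)        = inj₂ (sym-adj ab)
  closed (inj₂ (inj₁ refl)) (inj₂ (inj₁ refl)) = inj₁ refl
  closed (inj₂ (inj₁ refl)) (inj₂ (inj₂ refl)) = inj₂ bc
  closed (inj₂ (inj₂ refl)) (inj₁ refl)        = inj₂ (sym-adj ac)
  closed (inj₂ (inj₂ refl)) (inj₂ (inj₁ refl)) = inj₂ (sym-adj bc)
  closed (inj₂ (inj₂ refl)) (inj₂ (inj₂ refl)) = inj₁ refl

Dist-functional : ∀ {G u v k j} → Dist G u v k → Dist G u v j → k ≡ j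
Dist-functional (w , min) (w' , min') = ≤-antisym (min _ w') (min' _ w)

walk-zero : ∀ {G u v} → Walk G 0 u v → u ≡ v
walk-zero nil = refl

walk-one : ∀ {G u v} → Walk G 1 u v → Graph.Adj G u v
walk-one (cons adj nil) = adj

module _ {G H : Graph} (irrG : Irreflexive G) (irrH : Irreflexive H) where

  private
    adj⇒≢ : ∀ K → Irreflexive K → ∀ {x y} → Graph.Adj K x y → ¬ x ≡ y
    adj⇒≢ K irr adj refl = irr adj

    walk≥1 : ∀ {u v} → ¬ u ≡ v → ∀ m → Walk (G □ H) m u v → 1 ≤ m
    walk≥1 u≢v zero    w = ⊥-elim (u≢v (walk-zero w))
    walk≥1 u≢v (suc m) w = s≤s z≤n

    walk≥2 : ∀ {a a' b b'} → Graph.Adj G a a' → Graph.Adj H b b' →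
             ∀ m → Walk (G □ H) m (a , b) (a' , b') → 2 ≤ m
    walk≥2 adj adj' zero w = ⊥-elim (adj⇒≢ G irrG adj (cong proj₁ (walk-zero w)))
    walk≥2 adj adj' (suc zero) w with walk-one {G □ H} w
    ... | inj₁ (a≡a' , _) = ⊥-elim (adj⇒≢ G irrG adj a≡a')
    ... | inj₂ (_ , b≡b') = ⊥-elim (adj⇒≢ H irrH adj' b≡b')
    walk≥2 adj adj' (suc (suc m)) w = s≤s (s≤s z≤n)

  closed²⇒dist≤2 : ∀ {a a' b b'} → Closed G a a' → Closed H b b' →
                   Σ ℕ λ k → Dist (G □ H) (a , b) (a' , b') k × k ≤ 2
  closed²⇒dist≤2 (inj₁ refl) (inj₁ refl) = 0 , (nil , λ _ _ → z≤n) , z≤n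
  closed²⇒dist≤2 (inj₁ refl) (inj₂ adj) =
    1 , (cons (inj₁ (refl , adj)) nil , walk≥1 (λ e → adj⇒≢ H irrH adj (cong proj₂ e))) , s≤s z≤n
  closed²⇒dist≤2 (inj₂ adj) (inj₁ refl) =
    1 , (cons (inj₂ (adj , refl)) nil , walk≥1 (λ e → adj⇒≢ G irrG adj (cong proj₁ e))) , s≤s z≤n
  closed²⇒dist≤2 (inj₂ adj) (inj₂ adj') =
    2 , (cons (inj₂ (adj , refl)) (cons (inj₁ (refl , adj')) nil) , walk≥2 adj adj') , s≤s (s≤s z≤n)

module _ (G : EdgeGraph) (C : EdgeGraph.E G → Set) where

  Covered : EdgeGraph.V G → Set
  Covered v = Σ (EdgeGraph.E G) λ c → C c × Inc G v c

  UniqueCoveredEnd : EdgeGraph.E G → Set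
  UniqueCoveredEnd e =
    Σ (EdgeGraph.V G) λ v → Inc G v e × Covered v × (∀ w → Inc G w e → w ≡ v ⊎ ¬ Covered w)

  lineGraph-perfectCode : (∀ {w c c'} → C c → C c' → Inc G w c → Inc G w c' → c ≡ c') →
                          (∀ e → C e ⊎ (¬ C e × UniqueCoveredEnd e)) →
                          IsPerfectCode (LineGraph G) C
  lineGraph-perfectCode matching dominated e with dominated e
  ... | inj₁ Ce = e , Ce , inj₁ refl , unique
    where
    unique : ∀ c' → C c' → Closed (LineGraph G) e c' → c' ≡ e
    unique c' Cc' (inj₁ refl)                = refl
    unique c' Cc' (inj₂ (_ , w , we , wc')) = matching Cc' Ce wc' we
  ... | inj₂ (¬Ce , v , ve , (c , Cc , vc) , onlyV) =
    c , Cc , inj₂ ((λ { refl → ¬Ce Cc }) , v , ve , vc) , unique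
    where
    unique : ∀ c' → C c' → Closed (LineGraph G) e c' → c' ≡ c
    unique c' Cc' (inj₁ refl) = ⊥-elim (¬Ce Cc')
    unique c' Cc' (inj₂ (_ , w , we , wc')) with onlyV w we
    ... | inj₁ refl       = matching Cc' Cc wc' vc
    ... | inj₂ uncovered = ⊥-elim (uncovered (c' , Cc' , wc'))

LT-irreflexive : Irreflexive LT
LT-irreflexive (e≢e , _) = e≢e refl

LT-symmetric : ∀ {e f} → Graph.Adj LT e f → Graph.Adj LT f e
LT-symmetric (e≢f , v , ve , vf) = (λ f≡e → e≢f (sym f≡e)) , v , vf , ve

edgesAt : TVertex → Triangle LT
edgesAt (just (i , bs)) =
  ((i , bs) , (i , zero ∷ bs) , (i , suc zero ∷ bs)) ,
  (parent≢ zero , just (i , bs) , inj₁ refl , inj₂ refl) ,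
  ((λ ()) , just (i , bs) , inj₂ refl , inj₂ refl) ,
  (parent≢ (suc zero) , just (i , bs) , inj₁ refl , inj₂ refl)
  where
  parent≢ : ∀ b → ¬ (i , bs) ≡ (i , b ∷ bs)
  parent≢ b ()
edgesAt nothing =
  ((zero , []) , (suc zero , []) , (suc (suc zero) , [])) ,
  ((λ ()) , nothing , inj₂ refl , inj₂ refl) ,
  ((λ ()) , nothing , inj₂ refl , inj₂ refl) ,
  ((λ ()) , nothing , inj₂ refl , inj₂ refl)

incident⇒inEdgesAt : ∀ {v e} → Inc T v e → InTri LT e (edgesAt v)
incident⇒inEdgesAt {just _}  {_}                    (inj₁ refl) = inj₁ refl
incident⇒inEdgesAt {just _}  {_ , zero ∷ _}         (inj₂ refl) = inj₂ (inj₁ refl)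
incident⇒inEdgesAt {just _}  {_ , suc zero ∷ _}     (inj₂ refl) = inj₂ (inj₂ refl)
incident⇒inEdgesAt {nothing} {zero , []}            (inj₂ refl) = inj₁ refl
incident⇒inEdgesAt {nothing} {suc zero , []}        (inj₂ refl) = inj₂ (inj₁ refl)
incident⇒inEdgesAt {nothing} {suc (suc zero) , []}  (inj₂ refl) = inj₂ (inj₂ refl)

closed⇒sharedTriangle : ∀ {e f} → Closed LT e f → SharedTriangle LT e f
closed⇒sharedTriangle {e} (inj₁ refl)             = edgesAt (just e) , inj₁ refl , inj₁ refl
closed⇒sharedTriangle (inj₂ (_ , v , ve , vf)) = edgesAt v , incident⇒inEdgesAt ve , incident⇒inEdgesAt vf

commonTersquare⇒closed² : ∀ {u v} → CommonTersquare u v →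
                          Closed LT (proj₁ u) (proj₁ v) × Closed LT (proj₂ u) (proj₂ v)
commonTersquare⇒closed² (t , t') = sharedTriangle⇒closed LT LT-symmetric t , sharedTriangle⇒closed LT LT-symmetric t'

closed²⇒commonTersquare : ∀ {u v} → Closed LT (proj₁ u) (proj₁ v) → Closed LT (proj₂ u) (proj₂ v) →
                          CommonTersquare u v
closed²⇒commonTersquare c c' = closed⇒sharedTriangle c , closed⇒sharedTriangle c'

Rho-functional : ∀ {u v k j} → Rho u v k → Rho u v j → k ≡ j
Rho-functional (inj₁ (_ , d))  (inj₁ (_ , d'))  = Dist-functional d d'
Rho-functional (inj₁ (t , _))  (inj₂ (¬t , _))  = ⊥-elim (¬t t)
Rho-functional (inj₂ (¬t , _)) (inj₁ (t , _))   = ⊥-elim (¬t t)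
Rho-functional (inj₂ (_ , refl)) (inj₂ (_ , refl)) = refl

sphere2⇒commonTersquare : ∀ {s u} → Sphere2 s u → CommonTersquare u s
sphere2⇒commonTersquare (_ , inj₁ (t , _) , _)           = t
sphere2⇒commonTersquare (_ , inj₂ (_ , refl) , s≤s (s≤s ()))

commonTersquare⇒sphere2 : ∀ {s u} → CommonTersquare u s → Sphere2 s u
commonTersquare⇒sphere2 t with commonTersquare⇒closed² t
... | c , c' with closed²⇒dist≤2 LT-irreflexive LT-irreflexive c c'
... | k , d , k≤2 = k , inj₁ (t , d) , k≤2

-- Since ρ is functional, the nearest codeword of u is the centre of the unique sphere containing u.
isolated2PerfectCode : ∀ {S} →
  (∀ s s' → S s → S s' → ¬ Graph.Adj Γ₂ s s') →
  (∀ u → Σ V₂ λ s → S s × Sphere2 s u × (∀ s' → S s' → Sphere2 s' u → s' ≡ s)) →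
  IsIsolated2PerfectCode S
isolated2PerfectCode {S} isolated partition = record
  { isolated      = isolated
  ; uniqueNearest = uniqueNearest
  ; partition     = partition
  }
  where
  uniqueNearest : ∀ u → Σ ℕ λ k → RhoSet S u k ×
                    Σ V₂ (λ s → S s × Rho u s k × (∀ s' → S s' → Rho u s' k → s' ≡ s))
  uniqueNearest u with partition u
  ... | s , Ss , (k , ρ , k≤2) , unique =
    k , ((s , Ss , ρ) , minimal) , s , Ss , ρ , λ s' Ss' ρ' → unique s' Ss' (k , ρ' , k≤2)
    where
    minimal : ∀ s' j → S s' → Rho u s' j → k ≤ j
    minimal s' j Ss' ρ' with j ≤? 2
    ... | no  j≰2 = ≤-trans k≤2 (<⇒≤ (≰⇒> j≰2))
    ... | yes j≤2 with unique s' Ss' (j , ρ' , j≤2)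
    ...   | refl = ≤-reflexive (Rho-functional ρ ρ')

product-isIsolated2PerfectCode : ∀ {C₁ C₂} → IsPerfectCode LT C₁ → IsPerfectCode LT C₂ →
                                 IsIsolated2PerfectCode (λ u → C₁ (proj₁ u) × C₂ (proj₂ u))
product-isIsolated2PerfectCode {C₁} {C₂} code₁ code₂ = isolated2PerfectCode isolated partition
  where
  S : V₂ → Set
  S u = C₁ (proj₁ u) × C₂ (proj₂ u)

  isolated : ∀ s s' → S s → S s' → ¬ Graph.Adj Γ₂ s s'
  isolated _ _ (_ , c₂) (_ , c₂') (inj₁ (_ , adj)) = perfectCode-independent LT-irreflexive code₂ c₂ c₂' adj
  isolated _ _ (c₁ , _) (c₁' , _) (inj₂ (adj , _)) = perfectCode-independent LT-irreflexive code₁ c₁ c₁' adj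

  partition : ∀ u → Σ V₂ λ s → S s × Sphere2 s u × (∀ s' → S s' → Sphere2 s' u → s' ≡ s)
  partition (a , b) with code₁ a | code₂ b
  ... | c₁ , C₁c₁ , ac₁ , unique₁ | c₂ , C₂c₂ , bc₂ , unique₂ =
    (c₁ , c₂) , (C₁c₁ , C₂c₂) , commonTersquare⇒sphere2 (closed²⇒commonTersquare ac₁ bc₂) , unique
    where
    unique : ∀ s' → S s' → Sphere2 s' (a , b) → s' ≡ (c₁ , c₂)
    unique (a' , b') (C₁a' , C₂b') sphere with commonTersquare⇒closed² (sphere2⇒commonTersquare sphere)
    ... | aa' , bb' = cong₂ _,_ (unique₁ a' C₁a' aa') (unique₂ b' C₂b' bb')

-- The type of an edge records where the code edge dominating it lies: below it (among its two child
-- edges), the edge itself, or above it (its parent or its sibling).  Only codeAbove edges have an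
-- uncovered lower endpoint.
data EdgeType : Set where
  codeBelow inCode codeAbove : EdgeType

childType : EdgeType → Bool → EdgeType
childType codeBelow true  = inCode
childType codeBelow false = codeAbove
childType inCode    _     = codeAbove
childType codeAbove _     = codeBelow

childType≡codeBelow : ∀ t d → childType t d ≡ codeBelow → t ≡ codeAbove
childType≡codeBelow codeAbove _ _ = refl
childType≡codeBelow codeBelow true  ()
childType≡codeBelow codeBelow false ()
childType≡codeBelow inCode    _     ()

childType≡codeAbove : ∀ t d → childType t d ≡ codeAbove → ¬ t ≡ codeAbove
childType≡codeAbove codeAbove _ () refl

module TreeCode (choice : TNonRoot → Fin 2) where

  edgeType : TNonRoot → EdgeType
  edgeType (i , [])     = codeBelow
  edgeType (i , b ∷ bs) = childType (edgeType (i , bs)) (does (b Fin.≟ choice (i , bs)))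

  InCode : TNonRoot → Set
  InCode e = edgeType e ≡ inCode

  edgeType-chosen : ∀ {i b bs} → edgeType (i , bs) ≡ codeBelow → b ≡ choice (i , bs) → InCode (i , b ∷ bs)
  edgeType-chosen {i} {b} {bs} t b≡ rewrite t | dec-true (b Fin.≟ choice (i , bs)) b≡ = refl

  edgeType-unchosen : ∀ {i b bs} → edgeType (i , bs) ≡ codeBelow → ¬ b ≡ choice (i , bs) →
                  edgeType (i , b ∷ bs) ≡ codeAbove
  edgeType-unchosen {i} {b} {bs} t b≢ rewrite t | dec-false (b Fin.≟ choice (i , bs)) b≢ = refl

  edgeType-codeAbove-child : ∀ {i b bs} → edgeType (i , bs) ≡ codeAbove → edgeType (i , b ∷ bs) ≡ codeBelow
  edgeType-codeAbove-child t rewrite t = refl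

  inCode-parent : ∀ {i b bs} → InCode (i , b ∷ bs) → edgeType (i , bs) ≡ codeBelow × b ≡ choice (i , bs)
  inCode-parent {i} {b} {bs} c with edgeType (i , bs) | b Fin.≟ choice (i , bs)
  inCode-parent c  | codeBelow | yes b≡ = refl , b≡
  inCode-parent () | codeBelow | no _
  inCode-parent () | inCode    | _
  inCode-parent () | codeAbove | _

  inCode-matching : ∀ {w c c'} → InCode c → InCode c' → Inc T w c → Inc T w c' → c ≡ c'
  inCode-matching {c = _ , []} () _ _ _
  inCode-matching {c' = _ , []} _ () _ _
  inCode-matching _ _ (inj₁ refl) (inj₁ refl) = refl
  inCode-matching {c' = i , b ∷ bs} Cc Cc' (inj₁ refl) (inj₂ refl) =
    case trans (sym Cc) (proj₁ (inCode-parent {i} {b} {bs} Cc')) of λ ()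
  inCode-matching {c = i , b ∷ bs} Cc Cc' (inj₂ refl) (inj₁ refl) =
    case trans (sym Cc') (proj₁ (inCode-parent {i} {b} {bs} Cc)) of λ ()
  inCode-matching {c = i , b ∷ bs} {c' = _ , b' ∷ _} Cc Cc' (inj₂ refl) (inj₂ refl) =
    cong (λ b → i , b ∷ bs)
         (trans (proj₂ (inCode-parent {i} {b} {bs} Cc)) (sym (proj₂ (inCode-parent {i} {b'} {bs} Cc'))))

  CoveredVertex : TVertex → Set
  CoveredVertex = Covered T InCode

  root-uncovered : ¬ CoveredVertex nothing
  root-uncovered ((_ , []) , () , _)
  root-uncovered ((_ , _ ∷ _) , _ , inj₁ ())
  root-uncovered ((_ , _ ∷ _) , _ , inj₂ ())

  codeAbove-lowerEnd-uncovered : ∀ {e} → edgeType e ≡ codeAbove → ¬ CoveredVertex (just e)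
  codeAbove-lowerEnd-uncovered t (_ , Cc , inj₁ refl)           = case trans (sym t) Cc of λ ()
  codeAbove-lowerEnd-uncovered t ((_ , []) , () , inj₂ _)
  codeAbove-lowerEnd-uncovered t ((i , b ∷ bs) , Cc , inj₂ refl) =
    case trans (sym t) (proj₁ (inCode-parent {i} {b} {bs} Cc)) of λ ()

  codeBelow-upperEnd-uncovered : ∀ {e} → edgeType e ≡ codeBelow → ¬ CoveredVertex (parent e)
  codeBelow-upperEnd-uncovered {_ , []}     _ = root-uncovered
  codeBelow-upperEnd-uncovered {_ , _ ∷ _} t = codeAbove-lowerEnd-uncovered (childType≡codeBelow _ _ t)

  lowerEnd-covered : ∀ {e} → ¬ edgeType e ≡ codeAbove → CoveredVertex (just e)
  lowerEnd-covered {i , bs} t≢ with edgeType (i , bs) in t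
  ... | inCode    = (i , bs) , t , inj₁ refl
  ... | codeBelow = (i , choice (i , bs) ∷ bs) , edgeType-chosen t refl , inj₂ refl
  ... | codeAbove = ⊥-elim (t≢ refl)

  inCode-or-uniqueCoveredEnd : ∀ e → InCode e ⊎ (¬ InCode e × UniqueCoveredEnd T InCode e)
  inCode-or-uniqueCoveredEnd e with edgeType e in t
  ... | inCode    = inj₁ refl
  ... | codeBelow =
    inj₂ ((λ ()) , just e , inj₁ refl , lowerEnd-covered (λ t′ → case trans (sym t) t′ of λ ()) , onlyLower)
    where
    onlyLower : ∀ w → Inc T w e → w ≡ just e ⊎ ¬ CoveredVertex w
    onlyLower _ (inj₁ w≡) = inj₁ w≡
    onlyLower _ (inj₂ refl) = inj₂ (codeBelow-upperEnd-uncovered t)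
  ... | codeAbove =
    inj₂ ((λ ()) , parent e , inj₂ refl , upperEnd-covered e t , onlyUpper)
    where
    upperEnd-covered : ∀ e → edgeType e ≡ codeAbove → CoveredVertex (parent e)
    upperEnd-covered (_ , [])     ()
    upperEnd-covered (_ , _ ∷ _) t = lowerEnd-covered (childType≡codeAbove _ _ t)
    onlyUpper : ∀ w → Inc T w e → w ≡ parent e ⊎ ¬ CoveredVertex w
    onlyUpper _ (inj₁ refl) = inj₂ (codeAbove-lowerEnd-uncovered t)
    onlyUpper _ (inj₂ w≡) = inj₁ w≡

  inCode-perfect : IsPerfectCode LT InCode
  inCode-perfect = lineGraph-perfectCode T InCode inCode-matching inCode-or-uniqueCoveredEnd

choiceAt : ℕ → TNonRoot → Fin 2
choiceAt n (_ , bs) = if does (length bs ≟ n + n) then suc zero else zero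

choiceAt-off : ∀ n e → ¬ length (proj₂ e) ≡ n + n → ¬ suc zero ≡ choiceAt n e
choiceAt-off n (_ , bs) off rewrite dec-false (length bs ≟ n + n) off = λ ()

choiceAt-on : ∀ n e → length (proj₂ e) ≡ n + n → suc zero ≡ choiceAt n e
choiceAt-on n (_ , bs) on rewrite dec-true (length bs ≟ n + n) on = refl

onePairs : ℕ → List (Fin 2)
onePairs zero    = []
onePairs (suc j) = suc zero ∷ suc zero ∷ onePairs j

length-onePairs : ∀ j → length (onePairs j) ≡ j + j
length-onePairs zero    = refl
length-onePairs (suc j) = cong suc (trans (cong suc (length-onePairs j)) (sym (+-suc j j)))

length-onePairs≢ : ∀ {j n} → j < n → ¬ length (onePairs j) ≡ n + n
length-onePairs≢ {j} j<n e = <⇒≢ (+-mono-< j<n j<n) (trans (sym (length-onePairs j)) e)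

module _ (n : ℕ) where
  open TreeCode (choiceAt n)

  edgeType-onePairs : ∀ j → j ≤ n → edgeType (zero , onePairs j) ≡ codeBelow
  edgeType-onePairs zero    _    = refl
  edgeType-onePairs (suc j) j<n =
    edgeType-codeAbove-child {zero} {suc zero} {suc zero ∷ onePairs j}
      (edgeType-unchosen {zero} {suc zero} {onePairs j} (edgeType-onePairs j (<⇒≤ j<n))
                     (choiceAt-off n (zero , onePairs j) (length-onePairs≢ j<n)))

-- Along the all-ones path below root edge 0, the n-th code first picks a child at depth 2n; codes with
-- larger index pass that depth without picking, which separates them.
witness : ℕ → TNonRoot
witness j = zero , suc zero ∷ onePairs j

witness-inCode : ∀ n → TreeCode.InCode (choiceAt n) (witness n)
witness-inCode n = TreeCode.edgeType-chosen (choiceAt n) {zero} {suc zero} {onePairs n}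
  (edgeType-onePairs n n ≤-refl) (choiceAt-on n (zero , onePairs n) (length-onePairs n))

witness-notInCode : ∀ {m n} → m < n → ¬ TreeCode.InCode (choiceAt n) (witness m)
witness-notInCode {m} {n} m<n c =
  case trans (sym c) witness-codeAbove of λ ()
  where
  witness-codeAbove : TreeCode.edgeType (choiceAt n) (witness m) ≡ codeAbove
  witness-codeAbove = TreeCode.edgeType-unchosen (choiceAt n) {zero} {suc zero} {onePairs m}
    (edgeType-onePairs n m (<⇒≤ m<n)) (choiceAt-off n (zero , onePairs m) (length-onePairs≢ m<n))

codeSquare : ℕ → V₂ → Set
codeSquare n u = TreeCode.InCode (choiceAt n) (proj₁ u) × TreeCode.InCode (choiceAt n) (proj₂ u)

codeSquare-distinct : ∀ {m n} → m < n → ¬ SameSet (codeSquare m) (codeSquare n)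
codeSquare-distinct {m} m<n same =
  witness-notInCode m<n (proj₁ (proj₁ (same (witness m , witness m)) (witness-inCode m , witness-inCode m)))

theorem7 : Σ (ℕ → V₂ → Set) λ C →
             (∀ n → IsIsolated2PerfectCode (C n)) ×
             (∀ m n → ¬ (m ≡ n) → ¬ SameSet (C m) (C n))
theorem7 = codeSquare , isCode , distinct
  where
  isCode : ∀ n → IsIsolated2PerfectCode (codeSquare n)
  isCode n = product-isIsolated2PerfectCode inCode-perfect inCode-perfect
    where open TreeCode (choiceAt n)

  distinct : ∀ m n → ¬ m ≡ n → ¬ SameSet (codeSquare m) (codeSquare n)
  distinct m n m≢n same with <-cmp m n
  ... | tri< m<n _ _ = codeSquare-distinct m<n same
  ... | tri≈ _ m≡n _ = m≢n m≡n
  ... | tri> _ _ n<m = codeSquare-distinct n<m (λ u → swap (same u))
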